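{- There exist an integer $n\ge 2$, an elliptic curve $E$ given by a Weierstrass equation $Y^2+a_1XY+a_3Y=X^3+a_2X^2+a_4X+a_6$ over a field $K$, and points $P_1,\dots,P_n\in E(K)$ forming a simultaneous arithmetic progression of length $n$ on this equation, such that no $n-1$ of the points $P_1,\dots,P_n$ form a simultaneous arithmetic progression of length $n-1$ on this equation.
   Context: Points $P_1=(x_1,y_1),\dots,P_m=(x_m,y_m)$ on a given Weierstrass equation form a simultaneous arithmetic progression (s.a.p.) of length $m$ if (a) the $x$-coordinates, in the given order, form an arithmetic progression with nonzero common difference, and (b) there is a permutation $\sigma$ of $\{1,\dots,m\}$ such that $y_{\sigma(1)},\dots,y_{\sigma(m)}$ is an arithmetic progression. A set of $m$ points forms a s.a.p. if some ordering of it does. -}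

module Defs where

open import Level using (0ℓ)
open import Data.Nat.Base using (ℕ; zero; suc)
open import Data.Fin.Base using (Fin; toℕ)
open import Data.Fin.Permutation using (Permutation′; _⟨$⟩ʳ_)
open import Data.Product.Base using (Σ; ∃; _×_; _,_)
open import Relation.Nullary.Negation using (¬_)
open import Algebra.Bundles using (CommutativeRing)

record Field : Set₁ where
  field
    commRing : CommutativeRing 0ℓ 0ℓ
  open CommutativeRing commRing public
  field
    1≉0    : ¬ (1# ≈ 0#)
    inv    : ∀ x → ¬ (x ≈ 0#) → ∃ λ y → x * y ≈ 1#

module _ (K : Field) where
  open Field K

  ι : ℕ → Carrier
  ι zero    = 0#
  ι (suc n) = 1# + ι n

  record Weierstrass : Set where
    constructor weq
    field
      a₁ a₂ a₃ a₄ a₆ : Carrier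

  module _ (W : Weierstrass) where
    open Weierstrass W

    b₂ b₄ b₆ b₈ Δ : Carrier
    b₂ = a₁ * a₁ + ι 4 * a₂
    b₄ = ι 2 * a₄ + a₁ * a₃
    b₆ = a₃ * a₃ + ι 4 * a₆
    b₈ = a₁ * a₁ * a₆ + ι 4 * a₂ * a₆ - a₁ * a₃ * a₄ + a₂ * a₃ * a₃ - a₄ * a₄
    Δ = - (b₂ * b₂ * b₈) - ι 8 * b₄ * b₄ * b₄ - ι 27 * b₆ * b₆ + ι 9 * b₂ * b₄ * b₆

    IsElliptic : Set
    IsElliptic = ¬ (Δ ≈ 0#)

    record Point : Set where
      constructor pt
      field
        x y : Carrier
        onCurve : y * y + a₁ * x * y + a₃ * y ≈ x * x * x + a₂ * x * x + a₄ * x + a₆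

    open Point

    IsSAP : ∀ {m} → (Fin m → Point) → Set
    IsSAP {m} P =
      (Σ Carrier λ a → Σ Carrier λ d → ¬ (d ≈ 0#) ×
         (∀ i → x (P i) ≈ a + ι (toℕ i) * d))
      × (Σ (Permutation′ m) λ σ → Σ Carrier λ b → Σ Carrier λ e →
         (∀ i → y (P (σ ⟨$⟩ʳ i)) ≈ b + ι (toℕ i) * e))

-- The points (0,1), (1,0), (2,3), (3,2) lie on the elliptic curve
-- y² − 15/4 y = x³ − 11/2 x² + 29/4 x − 11/4 over ℚ.  Their x-coordinates are
-- 0,1,2,3 and their y-coordinates are the same numbers permuted by (0 1)(2 3),
-- so the four points form a s.a.p.  Three of them have x-coordinates in
-- progression only for x ∈ {0,1,2} or {1,2,3}, and the corresponding y-values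
-- {1,0,3} and {0,3,2} contain no three-term progression; this last step is a
-- finite check over all index triples and their orderings.

module Submission where

open import Defs
open import Data.Nat.Base using (ℕ; suc; _≤_; s≤s; z≤n)
open import Data.Fin.Base using (Fin; toℕ)
open import Data.Fin.Patterns using (0F; 1F; 2F; 3F)
open import Data.Fin.Properties using (all?) renaming (_≟_ to _≟ᶠ_)
open import Data.Fin.Permutation using (Permutation′; _⟨$⟩ʳ_; _⟨$⟩ˡ_; inverseˡ; id; swap)
open import Data.Integer.Base using (+_)
open import Data.Product.Base using (Σ; _×_; _,_)
open import Data.Rational.Base as ℚ using (ℚ; 0ℚ; _/_; 1/_; ≢-nonZero)
open import Data.Rational.Properties using (+-*-commutativeRing; *-inverseʳ) renaming (_≟_ to _≟ℚ_)
open import Data.Vec.Functional using (_∷_; [])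
open import Function.Base using (_∘_)
open import Function.Bundles using (Injection)
open import Function.Definitions using (Injective)
open import Function.Properties.Inverse using (Inverse⇒Injection)
import Relation.Binary.PropositionalEquality as ≡
open ≡ using (_≡_; _≢_; _≗_; refl; cong; cong₂; subst₂)
open import Relation.Nullary.Decidable using (Dec; _×-dec_; _→-dec_; ¬?; from-yes)
open import Relation.Nullary.Negation using (¬_; contradiction)

module _ (K : Field) where
  open Field K
  open import Relation.Binary.Reasoning.Setoid setoid

  IsAP₃ : (Fin 3 → Carrier) → Set
  IsAP₃ z = z 0F + z 2F ≈ z 1F + z 1F

  IsAP₃-resp-≗ : ∀ {z z′} → z ≗ z′ → IsAP₃ z → IsAP₃ z′
  IsAP₃-resp-≗ z≗z′ =
    subst₂ _≈_ (cong₂ _+_ (z≗z′ 0F) (z≗z′ 2F)) (cong₂ _+_ (z≗z′ 1F) (z≗z′ 1F))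

  ι-suc-step : ∀ a d n → a + ι K (suc n) * d ≈ (a + ι K n * d) + d
  ι-suc-step a d n = begin
    a + (1# + ι K n) * d      ≈⟨ +-congˡ (distribʳ d 1# (ι K n)) ⟩
    a + (1# * d + ι K n * d)  ≈⟨ +-congˡ (+-congʳ (*-identityˡ d)) ⟩
    a + (d + ι K n * d)       ≈⟨ +-congˡ (+-comm d (ι K n * d)) ⟩
    a + (ι K n * d + d)       ≈⟨ +-assoc a (ι K n * d) d ⟨
    (a + ι K n * d) + d       ∎

  midpoint-+ : ∀ c d → c + ((c + d) + d) ≈ (c + d) + (c + d)
  midpoint-+ c d = begin
    c + ((c + d) + d)  ≈⟨ +-assoc c (c + d) d ⟨
    (c + (c + d)) + d  ≈⟨ +-congʳ (+-comm c (c + d)) ⟩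
    ((c + d) + c) + d  ≈⟨ +-assoc (c + d) c d ⟩
    (c + d) + (c + d)  ∎

  ι-progression⇒IsAP₃ : ∀ {a d} {z : Fin 3 → Carrier} →
                        (∀ i → z i ≈ a + ι K (toℕ i) * d) → IsAP₃ z
  ι-progression⇒IsAP₃ {a} {d} {z} z≈ = begin
    z 0F + z 2F            ≈⟨ +-cong (z≈ 0F) (trans (z≈ 2F) z₂≈) ⟩
    c + ((c + d) + d)      ≈⟨ midpoint-+ c d ⟩
    (c + d) + (c + d)      ≈⟨ +-cong z₁≈ z₁≈ ⟨
    z 1F + z 1F            ∎
    where
    c = a + ι K 0 * d
    z₁≈ : z 1F ≈ c + d
    z₁≈ = trans (z≈ 1F) (ι-suc-step a d 0)
    z₂≈ : a + ι K 2 * d ≈ (c + d) + d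
    z₂≈ = trans (ι-suc-step a d 1) (+-congʳ (ι-suc-step a d 0))

  module _ (W : Weierstrass K) where
    open Point

    integer-graph⇒IsSAP : ∀ {m} (P : Fin m → Point K W) (σ : Permutation′ m) →
                          (∀ i → x (P i) ≈ ι K (toℕ i)) →
                          (∀ i → y (P (σ ⟨$⟩ʳ i)) ≈ ι K (toℕ i)) →
                          IsSAP K W P
    integer-graph⇒IsSAP P σ x≈ y≈ =
        (0# , 1# , 1≉0 , λ i → trans (x≈ i) (as-progression _))
      , (σ , 0# , 1# , λ i → trans (y≈ i) (as-progression _))
      where
      as-progression : ∀ c → c ≈ 0# + c * 1#
      as-progression c = sym (trans (+-identityˡ (c * 1#)) (*-identityʳ c))

    IsSAP₃⇒IsAP₃ : (P : Fin 3 → Point K W) → IsSAP K W P →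
                   IsAP₃ (x ∘ P) × Σ (Permutation′ 3) λ σ → IsAP₃ (y ∘ P ∘ (σ ⟨$⟩ʳ_))
    IsSAP₃⇒IsAP₃ P ((_ , _ , _ , x≈) , (σ , _ , _ , y≈)) =
      ι-progression⇒IsAP₃ x≈ , σ , ι-progression⇒IsAP₃ y≈

Distinct₃ : ∀ {a} {A : Set a} → (Fin 3 → A) → Set a
Distinct₃ f = f 0F ≢ f 1F × f 1F ≢ f 2F × f 0F ≢ f 2F

injective⇒distinct₃ : ∀ {a} {A : Set a} {f : Fin 3 → A} → Injective _≡_ _≡_ f → Distinct₃ f
injective⇒distinct₃ inj =
    (λ p → contradiction (inj p) λ ())
  , (λ p → contradiction (inj p) λ ())
  , (λ p → contradiction (inj p) λ ())

η₃ : ∀ {a} {A : Set a} (g : Fin 3 → A) → g ≗ g 0F ∷ g 1F ∷ g 2F ∷ []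
η₃ g 0F = refl
η₃ g 1F = refl
η₃ g 2F = refl

ℚ-field : Field
ℚ-field = record
  { commRing = +-*-commutativeRing
  ; 1≉0      = λ ()
  ; inv      = λ q q≢0 → 1/_ q {{≢-nonZero q≢0}} , *-inverseʳ q {{≢-nonZero q≢0}}
  }

E : Weierstrass ℚ-field
E = weq 0ℚ (ℚ.- (+ 11 / 2)) (ℚ.- (+ 15 / 4)) (+ 29 / 4) (ℚ.- (+ 11 / 4))

-- Δ = 40437/256
E-isElliptic : IsElliptic ℚ-field E
E-isElliptic ()

-- the permutation (0 1)(2 3)
pairSwap : Permutation′ 4
pairSwap = swap (swap id)

X Y : Fin 4 → ℚ
X i = ι ℚ-field (toℕ i)
Y i = X (pairSwap ⟨$⟩ˡ i)

on-E : ∀ i → let open Weierstrass E in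
       Y i ℚ.* Y i ℚ.+ a₁ ℚ.* X i ℚ.* Y i ℚ.+ a₃ ℚ.* Y i
         ≡ X i ℚ.* X i ℚ.* X i ℚ.+ a₂ ℚ.* X i ℚ.* X i ℚ.+ a₄ ℚ.* X i ℚ.+ a₆
on-E 0F = refl
on-E 1F = refl
on-E 2F = refl
on-E 3F = refl

P : Fin 4 → Point ℚ-field E
P i = pt (X i) (Y i) (on-E i)

P-isSAP : IsSAP ℚ-field E P
P-isSAP = integer-graph⇒IsSAP ℚ-field E P pairSwap (λ _ → refl) (λ i → cong X (inverseˡ pairSwap {i}))

NoSubprogression : (Fin 3 → Fin 4) → (Fin 3 → Fin 3) → Set
NoSubprogression f τ =
  Distinct₃ f → Distinct₃ τ → IsAP₃ ℚ-field (X ∘ f) → ¬ IsAP₃ ℚ-field (Y ∘ f ∘ τ)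

noSubprogression? : ∀ f τ → Dec (NoSubprogression f τ)
noSubprogression? f τ =
  distinct₃? f →-dec (distinct₃? τ →-dec (IsAP₃? (X ∘ f) →-dec ¬? (IsAP₃? (Y ∘ f ∘ τ))))
  where
  distinct₃? : ∀ {n} (g : Fin 3 → Fin n) → Dec (Distinct₃ g)
  distinct₃? g = ¬? (g 0F ≟ᶠ g 1F) ×-dec ¬? (g 1F ≟ᶠ g 2F) ×-dec ¬? (g 0F ≟ᶠ g 2F)
  IsAP₃? : ∀ z → Dec (IsAP₃ ℚ-field z)
  IsAP₃? z = z 0F ℚ.+ z 2F ≟ℚ z 1F ℚ.+ z 1F

noSubprogression : ∀ f τ → NoSubprogression f τ
noSubprogression f τ f-distinct τ-distinct x-ap y-ap =
  enumerated (f 0F) (f 1F) (f 2F) (τ 0F) (τ 1F) (τ 2F) f-distinct τ-distinct x-ap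
    (IsAP₃-resp-≗ ℚ-field (λ t → cong Y (≡.trans (cong f (η₃ τ t)) (η₃ f _))) y-ap)
  where
  enumerated : ∀ i j k s₀ s₁ s₂ → NoSubprogression (i ∷ j ∷ k ∷ []) (s₀ ∷ s₁ ∷ s₂ ∷ [])
  enumerated = from-yes
    (all? λ i → all? λ j → all? λ k → all? λ s₀ → all? λ s₁ → all? λ s₂ →
       noSubprogression? (i ∷ j ∷ k ∷ []) (s₀ ∷ s₁ ∷ s₂ ∷ []))

no-three-point-SAP : (f : Fin 3 → Fin 4) → Injective _≡_ _≡_ f → ¬ IsSAP ℚ-field E (P ∘ f)
no-three-point-SAP f f-injective sap =
  let (x-ap , τ , y-ap) = IsSAP₃⇒IsAP₃ ℚ-field E (P ∘ f) sap
      τ-injective = Injection.injective (Inverse⇒Injection τ)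
  in  noSubprogression f (τ ⟨$⟩ʳ_) (injective⇒distinct₃ f-injective)
        (injective⇒distinct₃ τ-injective) x-ap y-ap

theorem2 : Σ ℕ λ k → 1 ≤ k × Σ Field λ K → Σ (Weierstrass K) λ W →
    IsElliptic K W × Σ (Fin (suc k) → Point K W) λ P →
      IsSAP K W P ×
      ((f : Fin k → Fin (suc k)) → Injective _≡_ _≡_ f → ¬ IsSAP K W (P ∘ f))
theorem2 = 3 , s≤s z≤n , ℚ-field , E , E-isElliptic , P , P-isSAP , no-three-point-SAP
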